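{- Let $P$ be an infinite set and let $(P,\leq)$ and $(P,\preceq)$ be posets. The following are equivalent: (1) $(P,\leq)$ and $(P,\preceq)$ are rotation-equivalent; (2) there exist $A,C\subseteq P$ satisfying the conditions for a rotation of $(P,\leq)$ such that $\mathfrak R_{A,C}(P,\leq)=(P,\preceq)$; (3) for all $a,b,c\in P$, the posets $(\{a,b,c\},\leq)$ and $(\{a,b,c\},\preceq)$ are rotation-equivalent. Consequently, if two infinite posets on the same set are rotation-equivalent then a single rotation maps one to the other, and the result of applying two rotations in succession to an infinite poset is also obtained by a single rotation.
   Context: For a poset $(P,\leq)$: $x<y$ means $x\le y$, $x\ne y$; $x\perp y$ means incomparable; $X<Y$ means $x<y$ for all $x\in X,y\in Y$. A downset is $X$ with $y<x\in X\Rightarrow y\in X$; an up-set dually. The conditions for a rotation: $A,C$ disjoint, $A$ a downset, $C$ an up-set, $A<C$. With $B=P\setminus(A\cup C)$, $\mathfrak R_{A,C}(P,\leq)$ is $(P,\preceq')$ with $x\preceq' y$ iff: (i) $x,y$ both in $A$, both in $B$ or both in $C$, and $x\le y$; or (ii) $x\in B$, $y\in A$, $x\perp y$; or (iii) $x\in C$, $y\in A$; or (iv) $x\in C$, $y\in B$, $x\perp y$. Two posets on the same set are rotation-equivalent if one can be transformed into the other by a finite sequence of rotations, each applied to the current poset. $(\{a,b,c\},\leq)$ is the restriction of $\leq$ to $\{a,b,c\}$. -}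

module Defs where

open import Level using (0ℓ)
open import Data.Nat using (ℕ)
open import Data.Fin using (Fin)
open import Data.Product using (Σ; ∃; _×_; _,_)
open import Data.Sum using (_⊎_)
open import Data.Empty using (⊥)
open import Relation.Nullary using (¬_)
open import Relation.Binary.PropositionalEquality using (_≡_; _≢_)
open import Relation.Binary.Structures using (IsPartialOrder)
open import Function.Bundles using (_↔_; _⇔_)
open import Function.Definitions using (Injective)

Rel₀ : Set → Set₁
Rel₀ X = X → X → Set

Pred₀ : Set → Set₁
Pred₀ X = X → Set

IsPoset : {X : Set} → Rel₀ X → Set
IsPoset _≤_ = IsPartialOrder _≡_ _≤_

Infinite : Set → Set
Infinite X = ¬ (Σ ℕ λ n → Fin n ↔ X)

SameRel : {X : Set} → Rel₀ X → Rel₀ X → Set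
SameRel R S = ∀ x y → R x y ⇔ S x y

module _ {X : Set} (_≤_ : Rel₀ X) where

  Strict : Rel₀ X
  Strict x y = x ≤ y × x ≢ y

  Incomparable : Rel₀ X
  Incomparable x y = ¬ (x ≤ y) × ¬ (y ≤ x)

  IsDownset : Pred₀ X → Set
  IsDownset S = ∀ x y → Strict y x → S x → S y

  IsUpset : Pred₀ X → Set
  IsUpset S = ∀ x y → Strict x y → S x → S y

  RotationConditions : Pred₀ X → Pred₀ X → Set
  RotationConditions A C =
    (∀ x → A x → C x → ⊥) × IsDownset A × IsUpset C × (∀ x y → A x → C y → Strict x y)

  InB : Pred₀ X → Pred₀ X → Pred₀ X
  InB A C x = ¬ A x × ¬ C x

  Rotate : Pred₀ X → Pred₀ X → Rel₀ X
  Rotate A C x y =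
      (A x × A y × x ≤ y)
    ⊎ (InB A C x × InB A C y × x ≤ y)
    ⊎ (C x × C y × x ≤ y)
    ⊎ (InB A C x × A y × Incomparable x y)
    ⊎ (C x × A y)
    ⊎ (C x × InB A C y × Incomparable x y)

data RotEquiv {X : Set} : Rel₀ X → Rel₀ X → Set₁ where
  done : {R S : Rel₀ X} → SameRel R S → RotEquiv R S
  step : {R S : Rel₀ X} (A C : Pred₀ X) → RotationConditions R A C →
         RotEquiv (Rotate R A C) S → RotEquiv R S

Restrict : {T P : Set} → (T → P) → Rel₀ P → Rel₀ T
Restrict f R u v = R (f u) (f v)

-- f : T → P is an injection whose image is exactly {a, b, c},
-- i.e. T (with f) is a copy of the subset {a, b, c} of P
Enumerates : {T P : Set} → (T → P) → P → P → P → Set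
Enumerates {T} f a b c =
  Injective _≡_ _≡_ f
  × (∀ t → f t ≡ a ⊎ f t ≡ b ⊎ f t ≡ c)
  × (∃ λ t → f t ≡ a) × (∃ λ t → f t ≡ b) × (∃ λ t → f t ≡ c)

ThreePointCondition : {P : Set} → Rel₀ P → Rel₀ P → Set₁
ThreePointCondition {P} R S =
  (a b c : P) (T : Set) (f : T → P) → Enumerates f a b c →
  RotEquiv (Restrict f R) (Restrict f S)

SingleRotation : {P : Set} → Rel₀ P → Rel₀ P → Set₁
SingleRotation {P} R S =
  Σ (Pred₀ P) λ A → Σ (Pred₀ P) λ C → RotationConditions R A C × SameRel (Rotate R A C) S

-- Whether x ≤′ y holds after a rotation ℜ_{A,C} depends only on the parts (A, B or C)
-- of x and y and on [x ≤ y], [y ≤ x]; the rotation conditions, reflexivity and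
-- antisymmetry are likewise conditions on single pairs.  With excluded middle all of
-- these are coded by Booleans, so a pointwise statement about rotations reduces to a
-- finite check in this "pair model", settled by evaluation.  We obtain: rotations
-- preserve reflexivity and antisymmetry, ℜ_{C,A} inverts ℜ_{A,C}, a rotation keeping a
-- least element least is trivial, and two rotations compose to one (the composite
-- parts are read off from the sum of the two part-heights, which lies in a window of
-- width 3).  Composition gives (1) ⇒ (2) by induction on the sequence of rotations,
-- and (1) ⇒ (3) is restriction along an injection.  For (3) ⇒ (1) fix x₀ and rotate
-- so that x₀ becomes least (the normal form): rotation-equivalent orders have equal
-- normal forms, and comparing y with z in a normal form involves only x₀, y, z, so (3)
-- makes the normal forms of ≤ and ≼ equal.

module Submission where

open import Defs
open import Level using (0ℓ)
open import Axiom.ExcludedMiddle using (ExcludedMiddle)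
open import Data.Bool using (Bool; true; false; not; _∧_; _∨_; T)
open import Data.Unit using (tt)
open import Data.Empty using (⊥; ⊥-elim)
open import Data.Nat using (ℕ; _+_; _∸_; _≤ᵇ_)
open import Data.Fin using (Fin; zero; suc)
open import Data.Product using (Σ; ∃; _×_; _,_; proj₁; proj₂)
open import Data.Sum using (_⊎_; inj₁; inj₂)
open import Function using (_∘_)
open import Function.Bundles using (_⇔_; mk⇔; Equivalence)
open import Function.Definitions using (Injective)
import Function.Properties.Equivalence as ⇔
open import Relation.Nullary using (¬_; yes; no)
open import Relation.Nullary.Decidable using (isYes; toWitness; fromWitness)
open import Relation.Binary.Definitions using (DecidableEquality; Transitive)
open import Relation.Binary.PropositionalEquality
  using (_≡_; _≢_; refl; sym; trans; cong; cong₂; subst; module ≡-Reasoning)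
open import Relation.Binary.Structures using (IsPartialOrder)

infixr 4 _⇒_
_⇒_ : Bool → Bool → Bool
a ⇒ b = not a ∨ b

∧-intro : ∀ {a b} → T a → T b → T (a ∧ b)
∧-intro {true} p q = q

∧-fst : ∀ {a b} → T (a ∧ b) → T a
∧-fst {true} _ = tt

∧-snd : ∀ a {b} → T (a ∧ b) → T b
∧-snd true q = q

⇒-intro : ∀ {a b} → (T a → T b) → T (a ⇒ b)
⇒-intro {true}  f = f tt
⇒-intro {false} f = tt

⇒-elim : ∀ {a b} → T (a ⇒ b) → T a → T b
⇒-elim {true} q _ = q

not-intro : ∀ {b} {Q : Set} → (T b → Q) → ¬ Q → T (not b)
not-intro {true}  f ¬q = ¬q (f tt)
not-intro {false} f ¬q = tt

not-elim : ∀ {b} → T (not b) → ¬ T b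
not-elim {false} _ ()

_⇔ᵇ_ : Bool → Bool → Bool
a ⇔ᵇ b = (a ⇒ b) ∧ (b ⇒ a)

⇔ᵇ-sound : ∀ a b → T (a ⇔ᵇ b) → T a ⇔ T b
⇔ᵇ-sound a b h = mk⇔ (⇒-elim (∧-fst h)) (⇒-elim (∧-snd (a ⇒ b) h))

record Exhaustive (A : Set) : Set where
  field
    every       : (A → Bool) → Bool
    every-sound : ∀ f → T (every f) → ∀ a → T (f a)

open Exhaustive {{...}} public

-- A Boolean implication between predicates on an exhaustive type, verified by
-- evaluation (the argument tt type-checks exactly when the check succeeds).
byCases : {A : Set} {{_ : Exhaustive A}} (hyp concl : A → Bool) →
          T (every (λ a → hyp a ⇒ concl a)) → ∀ a → T (hyp a) → T (concl a)
byCases hyp concl h a = ⇒-elim (every-sound (λ a → hyp a ⇒ concl a) h a)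

instance
  exhaustiveBool : Exhaustive Bool
  exhaustiveBool = record { every = λ f → f true ∧ f false ; every-sound = sound }
    where
    sound : ∀ f → T (f true ∧ f false) → ∀ b → T (f b)
    sound f h true  = ∧-fst h
    sound f h false = ∧-snd (f true) h

  exhaustive× : {A B : Set} → {{Exhaustive A}} → {{Exhaustive B}} → Exhaustive (A × B)
  exhaustive× = record
    { every       = λ f → every (λ a → every (λ b → f (a , b)))
    ; every-sound = λ f h (a , b) → every-sound (λ b → f (a , b)) (every-sound _ h a) b }

data Part : Set where
  partA partB partC : Part

_==_ : Part → Part → Bool
partA == partA = true
partB == partB = true
partC == partC = true
_     == _     = false

==-sound : ∀ k l → T (k == l) → k ≡ l
==-sound partA partA _ = refl
==-sound partB partB _ = refl
==-sound partC partC _ = refl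

==-refl : ∀ k → T (k == k)
==-refl partA = tt
==-refl partB = tt
==-refl partC = tt

==-complete : ∀ {k l} → k ≡ l → T (k == l)
==-complete {k} refl = ==-refl k

isA isC : Part → Bool
isA k = k == partA
isC k = k == partC

instance
  exhaustivePart : Exhaustive Part
  exhaustivePart = record { every = λ f → f partA ∧ f partB ∧ f partC ; every-sound = sound }
    where
    sound : ∀ f → T (f partA ∧ f partB ∧ f partC) → ∀ k → T (f k)
    sound f h partA = ∧-fst h
    sound f h partB = ∧-fst (∧-snd (f partA) h)
    sound f h partC = ∧-snd (f partB) (∧-snd (f partA) h)

-- The pair model.  For two points x, y of a rotated order, everything about the
-- pair is described by the parts k, l of x and y, the Booleans le = [x ≤ y],
-- ge = [y ≤ x] and eq = [x ≡ y].

rotated : Part → Part → Bool → Bool → Bool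
rotated partA partA le ge = le
rotated partB partB le ge = le
rotated partC partC le ge = le
rotated partB partA le ge = not le ∧ not ge
rotated partC partA le ge = true
rotated partC partB le ge = not le ∧ not ge
rotated _     _     le ge = false

rotated-diagonal : ∀ k le ge → rotated k k le ge ≡ le
rotated-diagonal partA le ge = refl
rotated-diagonal partB le ge = refl
rotated-diagonal partC le ge = refl

downward upward separated rotationOK : Part → Part → Bool → Bool → Bool
downward  k l le eq = le ∧ not eq ∧ isA l ⇒ isA k
upward    k l le eq = le ∧ not eq ∧ isC k ⇒ isC l
separated k l le eq = isA k ∧ isC l ⇒ le ∧ not eq
rotationOK k l le eq = downward k l le eq ∧ upward k l le eq ∧ separated k l le eq

rotationOK-upward : ∀ k l le eq → T (rotationOK k l le eq) → T (upward k l le eq)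
rotationOK-upward k l le eq h = ∧-fst (∧-snd (downward k l le eq) h)

rotationOK-separated : ∀ k l le eq → T (rotationOK k l le eq) → T (separated k l le eq)
rotationOK-separated k l le eq h = ∧-snd (upward k l le eq) (∧-snd (downward k l le eq) h)

orderOK : Part → Part → Bool → Bool → Bool → Bool
orderOK k l le ge eq = (eq ⇒ (k == l) ∧ le ∧ ge) ∧ (le ∧ ge ⇒ eq)

validPair : Part → Part → Bool → Bool → Bool → Bool
validPair k l le ge eq = rotationOK k l le eq ∧ rotationOK l k ge eq ∧ orderOK k l le ge eq

validPair₂ : Part → Part → Part → Part → Bool → Bool → Bool → Bool
validPair₂ k₁ l₁ k₂ l₂ le ge eq =
  validPair k₁ l₁ le ge eq ∧
  rotationOK k₂ l₂ (rotated k₁ l₁ le ge) eq ∧ rotationOK l₂ k₂ (rotated l₁ k₁ ge le) eq ∧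
  (eq ⇒ k₂ == l₂)

opposite : Part → Part
opposite partA = partC
opposite partB = partB
opposite partC = partA

-- Give a point of the parts C, B, A the heights 0, 1, 2; after two
-- rotations a point has combined height in 0..4.  When all combined heights lie in
-- a window [w, w + 2], the two rotations are the single rotation whose parts are
-- read off from the position inside the window.
data Window : Set where
  low mid high : Window

base : Window → ℕ
base low  = 0
base mid  = 1
base high = 2

height : Part → ℕ
height partC = 0
height partB = 1
height partA = 2

partAt : ℕ → Part
partAt 0 = partC
partAt 1 = partB
partAt _ = partA

combinedHeight : Part → Part → ℕ
combinedHeight k₁ k₂ = height k₁ + height k₂

fits : Window → Part → Part → Bool
fits w k₁ k₂ = (base w ≤ᵇ combinedHeight k₁ k₂) ∧ (combinedHeight k₁ k₂ ≤ᵇ base w + 2)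

composite : Window → Part → Part → Part
composite w k₁ k₂ = partAt (combinedHeight k₁ k₂ ∸ base w)

instance
  exhaustiveWindow : Exhaustive Window
  exhaustiveWindow = record { every = λ f → f low ∧ f mid ∧ f high ; every-sound = sound }
    where
    sound : ∀ f → T (f low ∧ f mid ∧ f high) → ∀ w → T (f w)
    sound f h low  = ∧-fst h
    sound f h mid  = ∧-fst (∧-snd (f low) h)
    sound f h high = ∧-snd (f mid) (∧-snd (f low) h)

fits-mid : ∀ k₁ k₂ → ¬ (k₁ ≡ partA × k₂ ≡ partA) → ¬ (k₁ ≡ partC × k₂ ≡ partC) →
           T (fits mid k₁ k₂)
fits-mid partA partA ¬AA ¬CC = ⊥-elim (¬AA (refl , refl))
fits-mid partA partB ¬AA ¬CC = tt
fits-mid partA partC ¬AA ¬CC = tt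
fits-mid partB partA ¬AA ¬CC = tt
fits-mid partB partB ¬AA ¬CC = tt
fits-mid partB partC ¬AA ¬CC = tt
fits-mid partC partA ¬AA ¬CC = tt
fits-mid partC partB ¬AA ¬CC = tt
fits-mid partC partC ¬AA ¬CC = ⊥-elim (¬CC (refl , refl))

check-order : ∀ k l le ge eq → T (validPair k l le ge eq) →
              T (orderOK k l (rotated k l le ge) (rotated l k ge le) eq)
check-order k l le ge eq =
  byCases (λ (k , l , le , ge , eq) → validPair k l le ge eq)
          (λ (k , l , le , ge , eq) → orderOK k l (rotated k l le ge) (rotated l k ge le) eq)
          tt (k , l , le , ge , eq)

check-inverse-conditions : ∀ k l le ge eq → T (validPair k l le ge eq) →
                           T (rotationOK (opposite k) (opposite l) (rotated k l le ge) eq)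
check-inverse-conditions k l le ge eq =
  byCases (λ (k , l , le , ge , eq) → validPair k l le ge eq)
          (λ (k , l , le , ge , eq) → rotationOK (opposite k) (opposite l) (rotated k l le ge) eq)
          tt (k , l , le , ge , eq)

check-inverse-undoes : ∀ k l le ge eq → T (validPair k l le ge eq) →
  T (rotated (opposite k) (opposite l) (rotated k l le ge) (rotated l k ge le) ⇔ᵇ le)
check-inverse-undoes k l le ge eq =
  byCases (λ (k , l , le , ge , eq) → validPair k l le ge eq)
          (λ (k , l , le , ge , eq) →
             rotated (opposite k) (opposite l) (rotated k l le ge) (rotated l k ge le) ⇔ᵇ le)
          tt (k , l , le , ge , eq)

check-same-part : ∀ k l le ge eq → T (validPair k l le ge eq) →
                  T (le ∧ rotated k l le ge ⇒ k == l)
check-same-part k l le ge eq =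
  byCases (λ (k , l , le , ge , eq) → validPair k l le ge eq)
          (λ (k , l , le , ge , eq) → le ∧ rotated k l le ge ⇒ k == l)
          tt (k , l , le , ge , eq)

check-spread-high : ∀ k₁ l₁ k₂ l₂ le ge eq → T (validPair₂ k₁ l₁ k₂ l₂ le ge eq) →
                    T (isA k₁ ∧ isA k₂ ⇒ fits high l₁ l₂)
check-spread-high k₁ l₁ k₂ l₂ le ge eq =
  byCases (λ (k₁ , l₁ , k₂ , l₂ , le , ge , eq) → validPair₂ k₁ l₁ k₂ l₂ le ge eq)
          (λ (k₁ , l₁ , k₂ , l₂ , le , ge , eq) → isA k₁ ∧ isA k₂ ⇒ fits high l₁ l₂)
          tt (k₁ , l₁ , k₂ , l₂ , le , ge , eq)

check-spread-low : ∀ k₁ l₁ k₂ l₂ le ge eq → T (validPair₂ k₁ l₁ k₂ l₂ le ge eq) →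
                   T (isC k₁ ∧ isC k₂ ⇒ fits low l₁ l₂)
check-spread-low k₁ l₁ k₂ l₂ le ge eq =
  byCases (λ (k₁ , l₁ , k₂ , l₂ , le , ge , eq) → validPair₂ k₁ l₁ k₂ l₂ le ge eq)
          (λ (k₁ , l₁ , k₂ , l₂ , le , ge , eq) → isC k₁ ∧ isC k₂ ⇒ fits low l₁ l₂)
          tt (k₁ , l₁ , k₂ , l₂ , le , ge , eq)

check-composite-conditions : ∀ w k₁ l₁ k₂ l₂ le ge eq →
  T (validPair₂ k₁ l₁ k₂ l₂ le ge eq ∧ fits w k₁ k₂ ∧ fits w l₁ l₂) →
  T (rotationOK (composite w k₁ k₂) (composite w l₁ l₂) le eq)
check-composite-conditions w k₁ l₁ k₂ l₂ le ge eq =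
  byCases (λ (w , k₁ , l₁ , k₂ , l₂ , le , ge , eq) →
             validPair₂ k₁ l₁ k₂ l₂ le ge eq ∧ fits w k₁ k₂ ∧ fits w l₁ l₂)
          (λ (w , k₁ , l₁ , k₂ , l₂ , le , ge , eq) →
             rotationOK (composite w k₁ k₂) (composite w l₁ l₂) le eq)
          tt (w , k₁ , l₁ , k₂ , l₂ , le , ge , eq)

check-composite-rotates : ∀ w k₁ l₁ k₂ l₂ le ge eq →
  T (validPair₂ k₁ l₁ k₂ l₂ le ge eq ∧ fits w k₁ k₂ ∧ fits w l₁ l₂) →
  T (rotated (composite w k₁ k₂) (composite w l₁ l₂) le ge
       ⇔ᵇ rotated k₂ l₂ (rotated k₁ l₁ le ge) (rotated l₁ k₁ ge le))
check-composite-rotates w k₁ l₁ k₂ l₂ le ge eq =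
  byCases (λ (w , k₁ , l₁ , k₂ , l₂ , le , ge , eq) →
             validPair₂ k₁ l₁ k₂ l₂ le ge eq ∧ fits w k₁ k₂ ∧ fits w l₁ l₂)
          (λ (w , k₁ , l₁ , k₂ , l₂ , le , ge , eq) →
             rotated (composite w k₁ k₂) (composite w l₁ l₂) le ge
               ⇔ᵇ rotated k₂ l₂ (rotated k₁ l₁ le ge) (rotated l₁ k₁ ge le))
          tt (w , k₁ , l₁ , k₂ , l₂ , le , ge , eq)

-- the order axioms preserved by rotations
ReflAntisym : {X : Set} → Rel₀ X → Set
ReflAntisym Q = (∀ x → Q x x) × (∀ x y → Q x y → Q y x → x ≡ y)

module Codes {X : Set} (_≟_ : DecidableEquality X) where

  eqCode : X → X → Bool
  eqCode x y = isYes (x ≟ y)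

  eqCode-sound : ∀ {x y} → T (eqCode x y) → x ≡ y
  eqCode-sound = toWitness

  eqCode-complete : ∀ {x y} → x ≡ y → T (eqCode x y)
  eqCode-complete = fromWitness

  eqCode-sym : ∀ x y → eqCode x y ≡ eqCode y x
  eqCode-sym x y with x ≟ y | y ≟ x
  ... | yes _   | yes _   = refl
  ... | no  _   | no  _   = refl
  ... | yes x≡y | no  y≢x = ⊥-elim (y≢x (sym x≡y))
  ... | no  x≢y | yes y≡x = ⊥-elim (x≢y (sym y≡x))

  Decides : Rel₀ X → (X → X → Bool) → Set
  Decides Q ρ = ∀ x y → T (ρ x y) ⇔ Q x y

  Labels : Pred₀ X → Pred₀ X → (X → Part) → Set
  Labels A C κ = ∀ x → (A x ⇔ κ x ≡ partA) × (C x ⇔ κ x ≡ partC)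

  rotatedCode : (X → Part) → (X → X → Bool) → X → X → Bool
  rotatedCode κ ρ x y = rotated (κ x) (κ y) (ρ x y) (ρ y x)

  same-by-codes : ∀ {Q Q′ : Rel₀ X} {ρ ρ′ : X → X → Bool} → Decides Q ρ → Decides Q′ ρ′ →
                  (∀ x y → T (ρ x y) ⇔ T (ρ′ x y)) → SameRel Q Q′
  same-by-codes d d′ e x y = ⇔.trans (⇔.sym (d x y)) (⇔.trans (e x y) (d′ x y))

  module _ {Q : Rel₀ X} {ρ : X → X → Bool} (d : Decides Q ρ) where

    decoded : ∀ {x y} → T (ρ x y) → Q x y
    decoded = Equivalence.to (d _ _)

    encoded : ∀ {x y} → Q x y → T (ρ x y)
    encoded = Equivalence.from (d _ _)

    encoded-incomparable : ∀ {x y} → Incomparable Q x y → T (not (ρ x y) ∧ not (ρ y x))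
    encoded-incomparable (¬xy , ¬yx) = ∧-intro (not-intro decoded ¬xy) (not-intro decoded ¬yx)

    decoded-incomparable : ∀ {x y} → T (not (ρ x y) ∧ not (ρ y x)) → Incomparable Q x y
    decoded-incomparable {x} {y} h =
      (λ q → not-elim (∧-fst h) (encoded q)) , (λ q → not-elim (∧-snd (not (ρ x y)) h) (encoded q))

  module _ {A C : Pred₀ X} {κ : X → Part} (lab : Labels A C κ) where

    labelA : ∀ {x} → A x → κ x ≡ partA
    labelA = Equivalence.to (proj₁ (lab _))

    inA : ∀ {x} → κ x ≡ partA → A x
    inA = Equivalence.from (proj₁ (lab _))

    labelC : ∀ {x} → C x → κ x ≡ partC
    labelC = Equivalence.to (proj₂ (lab _))

    inC : ∀ {x} → κ x ≡ partC → C x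
    inC = Equivalence.from (proj₂ (lab _))

    labelB : ∀ (Q : Rel₀ X) {x} → InB Q A C x → κ x ≡ partB
    labelB Q {x} (¬a , ¬c) with κ x in e
    ... | partA = ⊥-elim (¬a (inA e))
    ... | partB = refl
    ... | partC = ⊥-elim (¬c (inC e))

    inB : ∀ (Q : Rel₀ X) {x} → κ x ≡ partB → InB Q A C x
    inB Q e = (λ a → B≢A (trans (sym e) (labelA a))) , (λ c → B≢C (trans (sym e) (labelC c)))
      where
      B≢A : partB ≢ partA
      B≢A ()
      B≢C : partB ≢ partC
      B≢C ()

  rotation-decided : ∀ {Q : Rel₀ X} {A C : Pred₀ X} {κ : X → Part} {ρ : X → X → Bool} →
                     Labels A C κ → Decides Q ρ →
                     Decides (Rotate Q A C) (rotatedCode κ ρ)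
  rotation-decided {Q} {A} {C} {κ} {ρ} lab d x y = mk⇔ decode encode
    where
    decode : T (rotatedCode κ ρ x y) → Rotate Q A C x y
    decode h with κ x in ex | κ y in ey
    ... | partA | partA = inj₁ (inA lab ex , inA lab ey , decoded d h)
    ... | partB | partB = inj₂ (inj₁ (inB lab Q ex , inB lab Q ey , decoded d h))
    ... | partC | partC = inj₂ (inj₂ (inj₁ (inC lab ex , inC lab ey , decoded d h)))
    ... | partB | partA = inj₂ (inj₂ (inj₂ (inj₁ (inB lab Q ex , inA lab ey , decoded-incomparable d h))))
    ... | partC | partA = inj₂ (inj₂ (inj₂ (inj₂ (inj₁ (inC lab ex , inA lab ey)))))
    ... | partC | partB = inj₂ (inj₂ (inj₂ (inj₂ (inj₂ (inC lab ex , inB lab Q ey , decoded-incomparable d h)))))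
    encode : Rotate Q A C x y → T (rotatedCode κ ρ x y)
    encode (inj₁ (a , a′ , q))
      rewrite labelA lab a | labelA lab a′ = encoded d q
    encode (inj₂ (inj₁ (b , b′ , q)))
      rewrite labelB lab Q b | labelB lab Q b′ = encoded d q
    encode (inj₂ (inj₂ (inj₁ (c , c′ , q))))
      rewrite labelC lab c | labelC lab c′ = encoded d q
    encode (inj₂ (inj₂ (inj₂ (inj₁ (b , a , i)))))
      rewrite labelB lab Q b | labelA lab a = encoded-incomparable d i
    encode (inj₂ (inj₂ (inj₂ (inj₂ (inj₁ (c , a))))))
      rewrite labelC lab c | labelA lab a = tt
    encode (inj₂ (inj₂ (inj₂ (inj₂ (inj₂ (c , b , i))))))
      rewrite labelC lab c | labelB lab Q b = encoded-incomparable d i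

  conditions-on-pair : ∀ {Q : Rel₀ X} {A C : Pred₀ X} {κ : X → Part} {ρ : X → X → Bool} →
                       Labels A C κ → Decides Q ρ → RotationConditions Q A C →
                       ∀ x y → T (rotationOK (κ x) (κ y) (ρ x y) (eqCode x y))
  conditions-on-pair {Q} {A} {C} {κ} {ρ} lab d (_ , down , up , A<C) x y =
    ∧-intro (⇒-intro downset-ok) (∧-intro (⇒-intro upset-ok) (⇒-intro A<C-ok))
    where
    e = eqCode x y
    strict : ∀ {b} → T (ρ x y ∧ not e ∧ b) → Strict Q x y
    strict h = decoded d (∧-fst h) , λ x≡y → not-elim (∧-fst (∧-snd (ρ x y) h)) (eqCode-complete x≡y)
    side : ∀ {b} → T (ρ x y ∧ not e ∧ b) → T b
    side h = ∧-snd (not e) (∧-snd (ρ x y) h)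
    downset-ok : T (ρ x y ∧ not e ∧ isA (κ y)) → T (isA (κ x))
    downset-ok h = ==-complete (labelA lab (down y x (strict h) (inA lab (==-sound _ _ (side h)))))
    upset-ok : T (ρ x y ∧ not e ∧ isC (κ x)) → T (isC (κ y))
    upset-ok h = ==-complete (labelC lab (up x y (strict h) (inC lab (==-sound _ _ (side h)))))
    A<C-ok : T (isA (κ x) ∧ isC (κ y)) → T (ρ x y ∧ not e)
    A<C-ok h with A<C x y (inA lab (==-sound _ _ (∧-fst h))) (inC lab (==-sound _ _ (∧-snd (isA (κ x)) h)))
    ... | q , x≢y = ∧-intro (encoded d q) (not-intro eqCode-sound x≢y)

  conditions-from-pairs : ∀ {Q : Rel₀ X} {A C : Pred₀ X} {κ : X → Part} {ρ : X → X → Bool} →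
                          Labels A C κ → Decides Q ρ →
    (∀ x y → T (rotationOK (κ x) (κ y) (ρ x y) (eqCode x y))) → RotationConditions Q A C
  conditions-from-pairs {Q} {A} {C} {κ} {ρ} lab d ok = disjoint , down , up , A<C
    where
    disjoint : ∀ x → A x → C x → ⊥
    disjoint x a c with trans (sym (labelA lab a)) (labelC lab c)
    ... | ()
    distinct : ∀ {x y} → x ≢ y → T (not (eqCode x y))
    distinct = not-intro eqCode-sound
    down : IsDownset Q A
    down x y (q , y≢x) a = inA lab (==-sound _ _
      (⇒-elim (∧-fst (ok y x)) (∧-intro (encoded d q) (∧-intro (distinct y≢x) (==-complete (labelA lab a))))))
    up : IsUpset Q C
    up x y (q , x≢y) c = inC lab (==-sound _ _
      (⇒-elim (rotationOK-upward (κ x) (κ y) (ρ x y) (eqCode x y) (ok x y))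
              (∧-intro (encoded d q) (∧-intro (distinct x≢y) (==-complete (labelC lab c))))))
    A<C : ∀ x y → A x → C y → Strict Q x y
    A<C x y a c with ⇒-elim (rotationOK-separated (κ x) (κ y) (ρ x y) (eqCode x y) (ok x y))
                            (∧-intro (==-complete (labelA lab a)) (==-complete (labelC lab c)))
    ... | h = decoded d (∧-fst h) , λ x≡y → not-elim (∧-snd (ρ x y) h) (eqCode-complete x≡y)

  order-on-pair : ∀ {Q : Rel₀ X} {ρ : X → X → Bool} (κ : X → Part) → Decides Q ρ → ReflAntisym Q →
                  ∀ x y → T (orderOK (κ x) (κ y) (ρ x y) (ρ y x) (eqCode x y))
  order-on-pair {Q} {ρ} κ d (reflexive , antisym) x y =
    ∧-intro (⇒-intro (λ t → on-diagonal (eqCode-sound t)))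
            (⇒-intro (λ h → eqCode-complete (antisym x y (decoded d (∧-fst h)) (decoded d (∧-snd (ρ x y) h)))))
    where
    on-diagonal : x ≡ y → T ((κ x == κ y) ∧ ρ x y ∧ ρ y x)
    on-diagonal refl = ∧-intro (==-refl (κ x)) (∧-intro (encoded d (reflexive x)) (encoded d (reflexive x)))

  reflAntisym-from-pairs : ∀ {Q : Rel₀ X} {ρ : X → X → Bool} (κ : X → Part) → Decides Q ρ →
    (∀ x y → T (orderOK (κ x) (κ y) (ρ x y) (ρ y x) (eqCode x y))) → ReflAntisym Q
  reflAntisym-from-pairs {Q} {ρ} κ d ok = reflexive , antisym
    where
    reflexive : ∀ x → Q x x
    reflexive x = decoded d (∧-fst (∧-snd (κ x == κ x) (⇒-elim (∧-fst (ok x x)) (eqCode-complete refl))))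
    antisym : ∀ x y → Q x y → Q y x → x ≡ y
    antisym x y q q′ = eqCode-sound (⇒-elim (∧-snd (eqCode x y ⇒ (κ x == κ y) ∧ ρ x y ∧ ρ y x) (ok x y))
                                            (∧-intro (encoded d q) (encoded d q′)))

  conditions-on-reversed-pair : ∀ {Q : Rel₀ X} {A C : Pred₀ X} {κ : X → Part} {ρ : X → X → Bool} →
                                Labels A C κ → Decides Q ρ → RotationConditions Q A C →
                                ∀ x y → T (rotationOK (κ y) (κ x) (ρ y x) (eqCode x y))
  conditions-on-reversed-pair {κ = κ} {ρ} lab d rc x y =
    subst (λ e → T (rotationOK (κ y) (κ x) (ρ y x) e)) (eqCode-sym y x) (conditions-on-pair lab d rc y x)

common-window : ∀ {X : Set} → ExcludedMiddle 0ℓ → (κ₁ κ₂ : X → Part) →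
  (∀ z x → T (isA (κ₁ z) ∧ isA (κ₂ z) ⇒ fits high (κ₁ x) (κ₂ x))) →
  (∀ z x → T (isC (κ₁ z) ∧ isC (κ₂ z) ⇒ fits low (κ₁ x) (κ₂ x))) →
  Σ Window λ w → ∀ x → T (fits w (κ₁ x) (κ₂ x))
common-window lem κ₁ κ₂ top bottom with lem {∃ λ z → κ₁ z ≡ partA × κ₂ z ≡ partA}
... | yes (z , A₁ , A₂) = high , λ x → ⇒-elim (top z x) (∧-intro (==-complete A₁) (==-complete A₂))
... | no noTop with lem {∃ λ z → κ₁ z ≡ partC × κ₂ z ≡ partC}
...   | yes (z , C₁ , C₂) = low , λ x → ⇒-elim (bottom z x) (∧-intro (==-complete C₁) (==-complete C₂))
...   | no noBottom = mid , λ x → fits-mid (κ₁ x) (κ₂ x) (λ AA → noTop (x , AA)) (λ CC → noBottom (x , CC))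

module Classical (lem : ExcludedMiddle 0ℓ) {X : Set} where

  _≟_ : DecidableEquality X
  x ≟ y = lem

  open Codes _≟_ public

  decide : Rel₀ X → X → X → Bool
  decide Q x y = isYes (lem {Q x y})

  decide-spec : (Q : Rel₀ X) → Decides Q (decide Q)
  decide-spec Q x y = mk⇔ toWitness fromWitness

  label : Pred₀ X → Pred₀ X → X → Part
  label A C x with lem {A x} | lem {C x}
  ... | yes _ | _     = partA
  ... | no _  | yes _ = partC
  ... | no _  | no _  = partB

  label-spec : ∀ A C → (∀ x → A x → C x → ⊥) → Labels A C (label A C)
  label-spec A C disjoint x with lem {A x} | lem {C x}
  ... | yes a  | _     = mk⇔ (λ _ → refl) (λ _ → a) , mk⇔ (λ c → ⊥-elim (disjoint x a c)) (λ ())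
  ... | no ¬a  | yes c = mk⇔ (λ a → ⊥-elim (¬a a)) (λ ()) , mk⇔ (λ _ → refl) (λ _ → c)
  ... | no ¬a  | no ¬c = mk⇔ (λ a → ⊥-elim (¬a a)) (λ ()) , mk⇔ (λ c → ⊥-elim (¬c c)) (λ ())

  module _ {R : Rel₀ X} {A C : Pred₀ X} (g : ReflAntisym R) (rc : RotationConditions R A C) where

    private
      κ = label A C
      ρ = decide R
      lab = label-spec A C (proj₁ rc)
      d = decide-spec R
      d′ = rotation-decided lab d

    valid-pair : ∀ x y → T (validPair (κ x) (κ y) (ρ x y) (ρ y x) (eqCode x y))
    valid-pair x y = ∧-intro (conditions-on-pair lab d rc x y)
                    (∧-intro (conditions-on-reversed-pair lab d rc x y) (order-on-pair κ d g x y))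

    rotation-reflAntisym : ReflAntisym (Rotate R A C)
    rotation-reflAntisym = reflAntisym-from-pairs κ d′ λ x y →
      check-order (κ x) (κ y) (ρ x y) (ρ y x) (eqCode x y) (valid-pair x y)

    rotation-inverse : RotationConditions (Rotate R A C) C A × SameRel (Rotate (Rotate R A C) C A) R
    rotation-inverse =
      conditions-from-pairs lab′ d′ (λ x y →
        check-inverse-conditions (κ x) (κ y) (ρ x y) (ρ y x) (eqCode x y) (valid-pair x y)) ,
      same-by-codes (rotation-decided lab′ d′) d (λ x y → ⇔ᵇ-sound _ _
        (check-inverse-undoes (κ x) (κ y) (ρ x y) (ρ y x) (eqCode x y) (valid-pair x y)))
      where
      opposite-A : ∀ k → opposite k ≡ partA → k ≡ partC
      opposite-A partC _ = refl
      opposite-C : ∀ k → opposite k ≡ partC → k ≡ partA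
      opposite-C partA _ = refl
      lab′ : Labels C A (λ x → opposite (κ x))
      lab′ x = mk⇔ (λ c → cong opposite (labelC lab c)) (λ e → inC lab (opposite-A _ e)) ,
               mk⇔ (λ a → cong opposite (labelA lab a)) (λ e → inA lab (opposite-C _ e))

    -- a rotation keeping a least element x₀ least is the identity: all points then
    -- lie in the part of x₀
    rotation-fixing-least : (x₀ : X) → (∀ y → R x₀ y) → (∀ y → Rotate R A C x₀ y) →
                            SameRel (Rotate R A C) R
    rotation-fixing-least x₀ least least′ =
      same-by-codes d′ d λ x y → subst (λ b → T (rotatedCode κ ρ x y) ⇔ T b) (unchanged x y) ⇔.refl
      where
      same-part : ∀ y → κ y ≡ κ x₀
      same-part y = sym (==-sound _ _ (⇒-elim
        (check-same-part (κ x₀) (κ y) (ρ x₀ y) (ρ y x₀) (eqCode x₀ y) (valid-pair x₀ y))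
        (∧-intro (encoded d (least y)) (encoded d′ (least′ y)))))
      unchanged : ∀ x y → rotatedCode κ ρ x y ≡ ρ x y
      unchanged x y = begin
        rotated (κ x) (κ y) (ρ x y) (ρ y x)
          ≡⟨ cong₂ (λ k l → rotated k l (ρ x y) (ρ y x)) (same-part x) (same-part y) ⟩
        rotated (κ x₀) (κ x₀) (ρ x y) (ρ y x)
          ≡⟨ rotated-diagonal (κ x₀) (ρ x y) (ρ y x) ⟩
        ρ x y ∎
        where open ≡-Reasoning

  rotation-compose : ∀ {R : Rel₀ X} {A C A′ C′ : Pred₀ X} → ReflAntisym R → RotationConditions R A C →
    RotationConditions (Rotate R A C) A′ C′ → SingleRotation R (Rotate (Rotate R A C) A′ C′)
  rotation-compose {R} {A} {C} {A′} {C′} g rc rc′ = A″ , C″ , composite-conditions , composite-rotates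
    where
    κ₁ = label A C
    κ₂ = label A′ C′
    ρ = decide R
    lab₁ = label-spec A C (proj₁ rc)
    lab₂ = label-spec A′ C′ (proj₁ rc′)
    d = decide-spec R
    d₁ = rotation-decided lab₁ d
    d₂ = rotation-decided lab₂ d₁
    valid₂ : ∀ x y → T (validPair₂ (κ₁ x) (κ₁ y) (κ₂ x) (κ₂ y) (ρ x y) (ρ y x) (eqCode x y))
    valid₂ x y = ∧-intro (valid-pair g rc x y)
      (∧-intro (conditions-on-pair lab₂ d₁ rc′ x y)
      (∧-intro (conditions-on-reversed-pair lab₂ d₁ rc′ x y)
               (⇒-intro (λ t → ==-complete (cong κ₂ (eqCode-sound t))))))
    window = common-window lem κ₁ κ₂
      (λ z x → check-spread-high (κ₁ z) (κ₁ x) (κ₂ z) (κ₂ x) (ρ z x) (ρ x z) (eqCode z x) (valid₂ z x))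
      (λ z x → check-spread-low (κ₁ z) (κ₁ x) (κ₂ z) (κ₂ x) (ρ z x) (ρ x z) (eqCode z x) (valid₂ z x))
    w = proj₁ window
    κ″ : X → Part
    κ″ x = composite w (κ₁ x) (κ₂ x)
    A″ C″ : Pred₀ X
    A″ x = κ″ x ≡ partA
    C″ x = κ″ x ≡ partC
    lab″ : Labels A″ C″ κ″
    lab″ x = ⇔.refl , ⇔.refl
    in-window : ∀ x y → T (validPair₂ (κ₁ x) (κ₁ y) (κ₂ x) (κ₂ y) (ρ x y) (ρ y x) (eqCode x y)
                           ∧ fits w (κ₁ x) (κ₂ x) ∧ fits w (κ₁ y) (κ₂ y))
    in-window x y = ∧-intro (valid₂ x y) (∧-intro (proj₂ window x) (proj₂ window y))
    composite-conditions : RotationConditions R A″ C″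
    composite-conditions = conditions-from-pairs lab″ d λ x y →
      check-composite-conditions w (κ₁ x) (κ₁ y) (κ₂ x) (κ₂ y) (ρ x y) (ρ y x) (eqCode x y) (in-window x y)
    composite-rotates : SameRel (Rotate R A″ C″) (Rotate (Rotate R A C) A′ C′)
    composite-rotates = same-by-codes (rotation-decided lab″ d) d₂ λ x y → ⇔ᵇ-sound _ _
      (check-composite-rotates w (κ₁ x) (κ₁ y) (κ₂ x) (κ₂ y) (ρ x y) (ρ y x) (eqCode x y) (in-window x y))

  empty-rotation : ∀ {R : Rel₀ X} → SameRel (Rotate R (λ _ → ⊥) (λ _ → ⊥)) R
  empty-rotation {R} = same-by-codes (rotation-decided all-B (decide-spec R)) (decide-spec R) λ _ _ → ⇔.refl
    where
    all-B : Labels (λ _ → ⊥) (λ _ → ⊥) (λ _ → partB)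
    all-B x = mk⇔ ⊥-elim (λ ()) , mk⇔ ⊥-elim (λ ())

  empty-conditions : ∀ {R : Rel₀ X} → RotationConditions R (λ _ → ⊥) (λ _ → ⊥)
  empty-conditions = (λ _ ()) , (λ _ _ _ ()) , (λ _ _ _ ()) , (λ _ _ ())

  rotation-cong : ∀ {R R′ : Rel₀ X} {A C : Pred₀ X} → (∀ x → A x → C x → ⊥) → SameRel R R′ →
                  SameRel (Rotate R A C) (Rotate R′ A C)
  rotation-cong {R} {R′} {A} {C} disjoint s =
    same-by-codes (rotation-decided lab d) (rotation-decided lab d′) λ _ _ → ⇔.refl
    where
    lab = label-spec A C disjoint
    d = decide-spec R
    d′ : Decides R′ (decide R)
    d′ x y = ⇔.trans (d x y) (s x y)

  conditions-cong : ∀ {R R′ : Rel₀ X} {A C : Pred₀ X} → SameRel R R′ →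
                    RotationConditions R A C → RotationConditions R′ A C
  conditions-cong s (disjoint , down , up , A<C) =
    disjoint ,
    (λ x y (q , y≢x) a → down x y (Equivalence.from (s y x) q , y≢x) a) ,
    (λ x y (q , x≢y) c → up x y (Equivalence.from (s x y) q , x≢y) c) ,
    (λ x y a c → Equivalence.to (s x y) (proj₁ (A<C x y a c)) , proj₂ (A<C x y a c))

  equiv-transport : ∀ {R R′ S : Rel₀ X} → SameRel R R′ → RotEquiv R S → RotEquiv R′ S
  equiv-transport s (done t) = done (λ x y → ⇔.trans (⇔.sym (s x y)) (t x y))
  equiv-transport s (step A C rc e) =
    step A C (conditions-cong s rc) (equiv-transport (rotation-cong (proj₁ rc) s) e)

  equiv-append : ∀ {R S U : Rel₀ X} → RotEquiv R S → RotEquiv S U → RotEquiv R U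
  equiv-append (done s) e = equiv-transport (λ x y → ⇔.sym (s x y)) e
  equiv-append (step A C rc e) e′ = step A C rc (equiv-append e e′)

  single-rotation-transport : ∀ {R U S : Rel₀ X} → SingleRotation R U → SameRel U S → SingleRotation R S
  single-rotation-transport (A , C , rc , s) t = A , C , rc , λ x y → ⇔.trans (s x y) (t x y)

  single-rotation : ∀ {R S : Rel₀ X} → ReflAntisym R → RotEquiv R S → SingleRotation R S
  single-rotation g (done s) =
    single-rotation-transport ((λ _ → ⊥) , (λ _ → ⊥) , empty-conditions , empty-rotation) s
  single-rotation g (step A C rc e) with single-rotation (rotation-reflAntisym g rc) e
  ... | A′ , C′ , rc′ , s′ = single-rotation-transport (rotation-compose g rc rc′) s′

  -- Normal forms: rotating by the points strictly below x₀ and the points above x₀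
  -- makes x₀ the least element.
  below : Rel₀ X → X → Pred₀ X
  below R x₀ y = R y x₀ × ¬ R x₀ y

  above : Rel₀ X → X → Pred₀ X
  above R x₀ y = R x₀ y

  normalForm : Rel₀ X → X → Rel₀ X
  normalForm R x₀ = Rotate R (below R x₀) (above R x₀)

  normalForm-conditions : ∀ {R : Rel₀ X} → Transitive R → ∀ x₀ → RotationConditions R (below R x₀) (above R x₀)
  normalForm-conditions {R} transitive x₀ = disjoint , down , up , below<above
    where
    disjoint : ∀ x → below R x₀ x → above R x₀ x → ⊥
    disjoint x (_ , ¬x₀x) x₀x = ¬x₀x x₀x
    down : IsDownset R (below R x₀)
    down x y (yx , _) (xx₀ , ¬x₀x) = transitive yx xx₀ , λ x₀y → ¬x₀x (transitive x₀y yx)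
    up : IsUpset R (above R x₀)
    up x y (xy , _) x₀x = transitive x₀x xy
    below<above : ∀ x y → below R x₀ x → above R x₀ y → Strict R x y
    below<above x y (xx₀ , ¬x₀x) x₀y = transitive xx₀ x₀y , λ { refl → ¬x₀x x₀y }

  normalForm-least : ∀ {R : Rel₀ X} → (∀ x → R x x) → ∀ x₀ y → normalForm R x₀ x₀ y
  normalForm-least {R} reflexive x₀ y with lem {R x₀ y} | lem {R y x₀}
  ... | yes x₀y | _      = inj₂ (inj₂ (inj₁ (reflexive x₀ , x₀y , x₀y)))
  ... | no ¬x₀y | yes yx₀ = inj₂ (inj₂ (inj₂ (inj₂ (inj₁ (reflexive x₀ , (yx₀ , ¬x₀y))))))
  ... | no ¬x₀y | no ¬yx₀ =
    inj₂ (inj₂ (inj₂ (inj₂ (inj₂ (reflexive x₀ , ((λ b → ¬yx₀ (proj₁ b)) , ¬x₀y) , (¬x₀y , ¬yx₀))))))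

  -- rotation-equivalent orders have the same normal forms: the chain
  -- normalForm R x₀ → R → … → S → normalForm S x₀ is a single rotation that keeps
  -- x₀ least, hence trivial
  normal-forms-agree : ∀ {R S : Rel₀ X} → ReflAntisym R → Transitive R → Transitive S → (∀ x → S x x) →
                       RotEquiv R S → ∀ x₀ → SameRel (normalForm R x₀) (normalForm S x₀)
  normal-forms-agree {R} {S} gR tR tS reflS e x₀ = trivial-single (single-rotation gN chain)
    where
    rcR = normalForm-conditions tR x₀
    gN = rotation-reflAntisym gR rcR
    back = rotation-inverse gR rcR
    to-normal-form : RotEquiv S (normalForm S x₀)
    to-normal-form = step (below S x₀) (above S x₀) (normalForm-conditions tS x₀) (done λ _ _ → ⇔.refl)
    chain : RotEquiv (normalForm R x₀) (normalForm S x₀)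
    chain = step (above R x₀) (below R x₀) (proj₁ back)
              (equiv-transport (λ x y → ⇔.sym (proj₂ back x y)) (equiv-append e to-normal-form))
    trivial-single : SingleRotation (normalForm R x₀) (normalForm S x₀) →
                     SameRel (normalForm R x₀) (normalForm S x₀)
    trivial-single (A , C , rc , same) x y = ⇔.trans (⇔.sym (trivial x y)) (same x y)
      where
      trivial = rotation-fixing-least gN rc x₀ (normalForm-least (proj₁ gR) x₀)
                  (λ y → Equivalence.from (same x₀ y) (normalForm-least reflS x₀ y))

  equiv-from-normal-forms : ∀ {R S : Rel₀ X} → Transitive R → ReflAntisym S → Transitive S →
                            ∀ x₀ → SameRel (normalForm R x₀) (normalForm S x₀) → RotEquiv R S
  equiv-from-normal-forms {R} {S} tR gS tS x₀ same =
    step (below R x₀) (above R x₀) (normalForm-conditions tR x₀)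
      (step (above S x₀) (below S x₀) (conditions-cong (λ x y → ⇔.sym (same x y)) (proj₁ back))
        (done (λ x y → ⇔.trans (rotation-cong (λ x a c → proj₂ c a) same x y) (proj₂ back x y))))
    where
    back = rotation-inverse gS (normalForm-conditions tS x₀)

conditions-restrict : ∀ {T P : Set} {R : Rel₀ P} {A C : Pred₀ P} (f : T → P) → Injective _≡_ _≡_ f →
  RotationConditions R A C → RotationConditions (Restrict f R) (A ∘ f) (C ∘ f)
conditions-restrict f injective (disjoint , down , up , A<C) =
  (λ t → disjoint (f t)) ,
  (λ t u (q , u≢t) a → down (f t) (f u) (q , λ e → u≢t (injective e)) a) ,
  (λ t u (q , t≢u) c → up (f t) (f u) (q , λ e → t≢u (injective e)) c) ,
  (λ t u a c → proj₁ (A<C (f t) (f u) a c) , λ { refl → proj₂ (A<C (f t) (f u) a c) refl })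

equiv-restrict : ∀ {T P : Set} {R S : Rel₀ P} (f : T → P) → Injective _≡_ _≡_ f →
                 RotEquiv R S → RotEquiv (Restrict f R) (Restrict f S)
equiv-restrict f injective (done s) = done (λ t u → s (f t) (f u))
equiv-restrict f injective (step A C rc e) =
  step (A ∘ f) (C ∘ f) (conditions-restrict f injective rc) (equiv-restrict f injective e)

triple : {P : Set} → P → P → P → Fin 3 → P
triple a b c zero             = a
triple a b c (suc zero)       = b
triple a b c (suc (suc zero)) = c

triple-enumerates : {P : Set} {a b c : P} → a ≢ b → a ≢ c → b ≢ c → Enumerates (triple a b c) a b c
triple-enumerates {a = a} {b} {c} a≢b a≢c b≢c =
  injective , covers , (zero , refl) , (suc zero , refl) , (suc (suc zero) , refl)
  where
  injective : Injective _≡_ _≡_ (triple a b c)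
  injective {zero}           {zero}           _ = refl
  injective {zero}           {suc zero}       e = ⊥-elim (a≢b e)
  injective {zero}           {suc (suc zero)} e = ⊥-elim (a≢c e)
  injective {suc zero}       {zero}           e = ⊥-elim (a≢b (sym e))
  injective {suc zero}       {suc zero}       _ = refl
  injective {suc zero}       {suc (suc zero)} e = ⊥-elim (b≢c e)
  injective {suc (suc zero)} {zero}           e = ⊥-elim (a≢c (sym e))
  injective {suc (suc zero)} {suc zero}       e = ⊥-elim (b≢c (sym e))
  injective {suc (suc zero)} {suc (suc zero)} _ = refl
  covers : ∀ t → triple a b c t ≡ a ⊎ triple a b c t ≡ b ⊎ triple a b c t ≡ c
  covers zero             = inj₁ refl
  covers (suc zero)       = inj₂ (inj₁ refl)
  covers (suc (suc zero)) = inj₂ (inj₂ refl)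

poset-reflAntisym : {X : Set} {R : Rel₀ X} → IsPoset R → ReflAntisym R
poset-reflAntisym p = (λ x → IsPartialOrder.refl p) , (λ x y → IsPartialOrder.antisym p)

-- (3) ⇒ equal normal forms: for distinct y, z the triple x₀, y, z carries the
-- comparison of y and z in the normal forms; the degenerate pairs are settled by
-- reflexivity and by x₀ being least
normal-forms-from-triples : (lem : ExcludedMiddle 0ℓ) → ∀ {P : Set} {R S : Rel₀ P} → IsPoset R → IsPoset S →
  ThreePointCondition R S → ∀ x₀ → SameRel (Classical.normalForm lem R x₀) (Classical.normalForm lem S x₀)
normal-forms-from-triples lem {P} {R} {S} pR pS three x₀ = agree
  where
  open Classical lem
  gR = poset-reflAntisym pR
  gS = poset-reflAntisym pS
  gR′ = rotation-reflAntisym gR (normalForm-conditions (IsPartialOrder.trans pR) x₀)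
  gS′ = rotation-reflAntisym gS (normalForm-conditions (IsPartialOrder.trans pS) x₀)

  on-triple : ∀ {y z} → y ≢ z → y ≢ x₀ → z ≢ x₀ → normalForm R x₀ y z ⇔ normalForm S x₀ y z
  on-triple {y} {z} y≢z y≢x₀ z≢x₀ =
    normal-forms-agree (restricted-reflAntisym gR) (IsPartialOrder.trans pR) (IsPartialOrder.trans pS)
                       (λ _ → IsPartialOrder.refl pS) (three x₀ y z (Fin 3) f enumerates) zero
                       (suc zero) (suc (suc zero))
    where
    f = triple x₀ y z
    enumerates = triple-enumerates (λ e → y≢x₀ (sym e)) (λ e → z≢x₀ (sym e)) y≢z
    restricted-reflAntisym : ReflAntisym R → ReflAntisym (Restrict f R)
    restricted-reflAntisym (reflexive , antisym) =
      (λ t → reflexive (f t)) , (λ t u q q′ → proj₁ enumerates (antisym (f t) (f u) q q′))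

  agree : SameRel (normalForm R x₀) (normalForm S x₀)
  agree y z with lem {y ≡ z} | lem {y ≡ x₀} | lem {z ≡ x₀}
  ... | yes refl | _ | _ = mk⇔ (λ _ → proj₁ gS′ y) (λ _ → proj₁ gR′ y)
  ... | no _ | yes refl | _ = mk⇔ (λ _ → normalForm-least (proj₁ gS) x₀ z) (λ _ → normalForm-least (proj₁ gR) x₀ z)
  ... | no _ | no y≢x₀ | yes refl =
    mk⇔ (λ yx₀ → ⊥-elim (y≢x₀ (proj₂ gR′ y x₀ yx₀ (normalForm-least (proj₁ gR) x₀ y))))
        (λ yx₀ → ⊥-elim (y≢x₀ (proj₂ gS′ y x₀ yx₀ (normalForm-least (proj₁ gS) x₀ y))))
  ... | no y≢z | no y≢x₀ | no z≢x₀ = on-triple y≢z y≢x₀ z≢x₀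

proposition3p19 : ExcludedMiddle 0ℓ →
    (P : Set) → Infinite P →
    (_≤_ _≼_ : Rel₀ P) → IsPoset _≤_ → IsPoset _≼_ →
    ((RotEquiv _≤_ _≼_ ⇔ SingleRotation _≤_ _≼_)
     × (RotEquiv _≤_ _≼_ ⇔ ThreePointCondition _≤_ _≼_))
    × ((A C : Pred₀ P) → RotationConditions _≤_ A C →
       (A′ C′ : Pred₀ P) → RotationConditions (Rotate _≤_ A C) A′ C′ →
       SingleRotation _≤_ (Rotate (Rotate _≤_ A C) A′ C′))
proposition3p19 lem P _ _≤_ _≼_ p≤ p≼ =
  (mk⇔ (single-rotation g≤) from-single , mk⇔ to-triples from-triples) ,
  λ A C rc A′ C′ rc′ → rotation-compose g≤ rc rc′
  where
  open Classical lem
  g≤ = poset-reflAntisym p≤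

  from-single : SingleRotation _≤_ _≼_ → RotEquiv _≤_ _≼_
  from-single (A , C , rc , same) = step A C rc (done same)

  to-triples : RotEquiv _≤_ _≼_ → ThreePointCondition _≤_ _≼_
  to-triples e a b c T f enumerates = equiv-restrict f (proj₁ enumerates) e

  from-triples : ThreePointCondition _≤_ _≼_ → RotEquiv _≤_ _≼_
  from-triples three with lem {P}
  ... | no empty = done λ x → ⊥-elim (empty x)
  ... | yes x₀ = equiv-from-normal-forms (IsPartialOrder.trans p≤) (poset-reflAntisym p≼)
                   (IsPartialOrder.trans p≼) x₀ (normal-forms-from-triples lem p≤ p≼ three x₀)
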